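{- There is no infinite parameterized-square-free word.
   Context: A parameterized square is a word $uv$ with $|u|=|v|\ge 1$ and a bijection $f:\mathrm{Alph}(u)\to\mathrm{Alph}(v)$ ($\mathrm{Alph}$ = set of letters occurring) with $v[t]=f(u[t])$ for all $t$. A (finite or infinite) word is parameterized-square-free if none of its finite factors is a parameterized square of length greater than $3$. -}

module Defs where

open import Level using (Level)
open import Data.Nat using (ℕ; _+_; _<_; _≤_)
open import Data.Fin using (Fin; toℕ)
open import Data.Product using (Σ; ∃-syntax; _×_; proj₁; _,_)
open import Relation.Binary.PropositionalEquality using (_≡_)
open import Relation.Nullary using (¬_)

private variable a : Level

-- A finite word of length n over alphabet A: positions Fin n.
-- Alph(u): set of letters occurring in u, as a subtype of A.
-- Its elements are compared by their underlying letter (proj₁).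
Alph : {A : Set a} {n : ℕ} → (Fin n → A) → Set a
Alph {A = A} u = Σ A (λ c → ∃[ t ] u t ≡ c)

record PSquareWitness {A : Set a} {n : ℕ} (u v : Fin n → A) : Set a where
  field
    f         : Alph u → Alph v
    f-cong    : ∀ (x y : Alph u) → proj₁ x ≡ proj₁ y → proj₁ (f x) ≡ proj₁ (f y)
    f-inj     : ∀ (x y : Alph u) → proj₁ (f x) ≡ proj₁ (f y) → proj₁ x ≡ proj₁ y
    f-surj    : ∀ (y : Alph v) → Σ (Alph u) (λ (x : Alph u) → proj₁ (f x) ≡ proj₁ y)
    f-maps    : ∀ t → v t ≡ proj₁ (f (u t , t , _≡_.refl))

IsParamSquare : {A : Set a} (n : ℕ) → (Fin n → A) → (Fin n → A) → Set a
IsParamSquare n u v = (1 ≤ n) × PSquareWitness u v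

ParamSquareFree : {A : Set a} → (ℕ → A) → Set a
ParamSquareFree w =
  ∀ (i n : ℕ) → 3 < n + n →
    ¬ IsParamSquare n (λ t → w (i + toℕ t)) (λ t → w (i + n + toℕ t))

module Submission where

-- A word uv (|u| = |v|) is a parameterized square exactly when u and v have
-- the same equality kernel: u t ≡ u t' iff v t ≡ v t'.
-- Shifting a square-free word keeps it square-free, so every local fact can be
-- stated at the start of the word.  Writing eᵢ for "xᵢ ≡ xᵢ₊₁":
--   * the squares aa·aa and ab·ab of length 4 are excluded, so eᵢ and eᵢ₊₂
--     are never both true and never both false;
--   * hence e₀ ∧ e₁ would force the word to begin with the square aaab·aaab
--     of length 8, so no letter occurs three times in a row;
--   * a case analysis on e₀ and e₁ now produces two consecutive true eⱼ with
--     j ≤ 3, a contradiction.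
-- Excluded middle is only used under a double negation, as the goal is ⊥.

open import Defs
open import Level using (Level)
open import Data.Nat using (ℕ; _+_; _≤_; _<_; s≤s; z≤n)
open import Data.Nat.Properties using (+-assoc; ≤-refl; m≤m+n)
open import Data.Fin using (Fin; toℕ; zero; suc)
open import Data.Bool using (Bool; true; false; if_then_else_)
open import Data.Unit using (⊤)
open import Data.Product using (_×_; _,_; proj₁; proj₂)
open import Data.Empty using (⊥; ⊥-elim)
open import Function.Definitions using (Injective)
open import Relation.Nullary using (¬_)
open import Relation.Binary.PropositionalEquality
  using (_≡_; _≢_; _≗_; refl; sym; trans; cong; module ≡-Reasoning)

private
  variable
    ℓ : Level
    A B C : Set ℓ
    n : ℕ

_≈ker_ : (Fin n → A) → (Fin n → B) → Set _
u ≈ker v = ∀ t t' → (u t ≡ u t' → v t ≡ v t') × (v t ≡ v t' → u t ≡ u t')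

≈ker-sym : {u : Fin n → A} {v : Fin n → B} → u ≈ker v → v ≈ker u
≈ker-sym k t t' = proj₂ (k t t') , proj₁ (k t t')

≈ker-trans : {u : Fin n → A} {v : Fin n → B} {w : Fin n → C} →
             u ≈ker v → v ≈ker w → u ≈ker w
≈ker-trans k l t t' =
  (λ e → proj₁ (l t t') (proj₁ (k t t') e)) ,
  (λ e → proj₂ (k t t') (proj₂ (l t t') e))

≗⇒≈ker : {u v : Fin n → A} → u ≗ v → u ≈ker v
≗⇒≈ker p t t' =
  (λ e → trans (sym (p t)) (trans e (p t'))) ,
  (λ e → trans (p t) (trans e (sym (p t'))))

relabelling⇒≈ker : {u : Fin n → A} {c : Fin n → B} (s : B → A) →
                   Injective _≡_ _≡_ s → (∀ t → u t ≡ s (c t)) → u ≈ker c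
relabelling⇒≈ker s s-inj r t t' =
  (λ e → s-inj (trans (sym (r t)) (trans e (r t')))) ,
  (λ e → trans (r t) (trans (cong s e) (sym (r t'))))

witness⇒≈ker : {u v : Fin n → A} → PSquareWitness u v → u ≈ker v
witness⇒≈ker {u = u} W t t' =
  (λ e → trans (f-maps t) (trans (f-cong (occ t) (occ t') e) (sym (f-maps t')))) ,
  (λ e → f-inj (occ t) (occ t') (trans (sym (f-maps t)) (trans e (f-maps t'))))
  where
    open PSquareWitness W
    occ : ∀ t → Alph u
    occ t = u t , t , refl

-- Conversely, equal kernels make u t ↦ v t a well-defined bijection of alphabets.
≈ker⇒witness : {u v : Fin n → A} → u ≈ker v → PSquareWitness u v
≈ker⇒witness {u = u} {v} k = record
  { f      = λ { (_ , t , _) → v t , t , refl }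
  ; f-cong = λ { (_ , t , p) (_ , t' , p') e →
                   proj₁ (k t t') (trans p (trans e (sym p'))) }
  ; f-inj  = λ { (_ , t , p) (_ , t' , p') e →
                   trans (sym p) (trans (proj₂ (k t t') e) p') }
  ; f-surj = λ { (_ , t , p) → (u t , t , refl) , p }
  ; f-maps = λ _ → refl
  }

square-resp-≗ : {u u' v v' : Fin n → A} → u ≗ u' → v ≗ v' →
                IsParamSquare n u v → IsParamSquare n u' v'
square-resp-≗ pu pv (n≥1 , W) =
  n≥1 , ≈ker⇒witness
          (≈ker-trans (≗⇒≈ker (λ t → sym (pu t)))
            (≈ker-trans (witness⇒≈ker W) (≗⇒≈ker pv)))

shift : ℕ → (ℕ → A) → ℕ → A
shift k x m = x (k + m)

prefix : (ℕ → A) → (n : ℕ) → Fin n → A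
prefix x n t = x (toℕ t)

shift-free : (x : ℕ → A) (k : ℕ) → ParamSquareFree x → ParamSquareFree (shift k x)
shift-free x k free i n long sq =
  free (k + i) n long (square-resp-≗ first-half second-half sq)
  where
    open ≡-Reasoning
    first-half : ∀ t → x (k + (i + toℕ t)) ≡ x (k + i + toℕ t)
    first-half t = cong x (sym (+-assoc k i (toℕ t)))
    second-half : ∀ t → x (k + (i + n + toℕ t)) ≡ x (k + i + n + toℕ t)
    second-half t = cong x (begin
      k + (i + n + toℕ t)  ≡⟨ sym (+-assoc k (i + n) (toℕ t)) ⟩
      k + (i + n) + toℕ t  ≡⟨ cong (_+ toℕ t) (sym (+-assoc k i n)) ⟩
      k + i + n + toℕ t    ∎)

record SquareFreeWord (A : Set ℓ) : Set ℓ where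
  field
    letter : ℕ → A
    free   : ParamSquareFree letter

open SquareFreeWord

suffix : ℕ → SquareFreeWord A → SquareFreeWord A
suffix k y = record { letter = shift k (letter y) ; free = shift-free (letter y) k (free y) }

no-square-at-start : (y : SquareFreeWord A) {c : Fin n → B} → 1 ≤ n → 3 < n + n →
                     prefix (letter y) n ≈ker c → prefix (letter (suffix n y)) n ≈ker c → ⊥
no-square-at-start {n = n} y n≥1 long p q =
  free y 0 n long (n≥1 , ≈ker⇒witness (≈ker-trans p (≈ker-sym q)))

aa : Fin 2 → ⊤
aa _ = _

ab : Fin 2 → Bool
ab zero       = false
ab (suc zero) = true

aaab : Fin 4 → Bool
aaab (suc (suc (suc zero))) = true
aaab _                      = false

select : A → A → Bool → A
select p q β = if β then q else p

select-injective : {p q : A} → p ≢ q → Injective _≡_ _≡_ (select p q)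
select-injective p≢q {false} {false} _ = refl
select-injective p≢q {false} {true}  e = ⊥-elim (p≢q e)
select-injective p≢q {true}  {false} e = ⊥-elim (p≢q (sym e))
select-injective p≢q {true}  {true}  _ = refl

aa-prefix : (y : ℕ → A) → y 0 ≡ y 1 → prefix y 2 ≈ker aa
aa-prefix y e₀ = relabelling⇒≈ker (λ _ → y 0) (λ _ → refl) relabel
  where
    relabel : ∀ t → y (toℕ t) ≡ y 0
    relabel zero       = refl
    relabel (suc zero) = sym e₀

ab-prefix : (y : ℕ → A) → y 0 ≢ y 1 → prefix y 2 ≈ker ab
ab-prefix y n₀ = relabelling⇒≈ker (select (y 0) (y 1)) (select-injective n₀) relabel
  where
    relabel : ∀ t → y (toℕ t) ≡ select (y 0) (y 1) (ab t)
    relabel zero       = refl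
    relabel (suc zero) = refl

aaab-prefix : (y : ℕ → A) → y 0 ≡ y 1 → y 1 ≡ y 2 → y 2 ≢ y 3 → prefix y 4 ≈ker aaab
aaab-prefix y e₀ e₁ n₂ =
  relabelling⇒≈ker (select (y 0) (y 3)) (select-injective y₀≢y₃) relabel
  where
    y₀≢y₃ : y 0 ≢ y 3
    y₀≢y₃ e = n₂ (trans (sym (trans e₀ e₁)) e)
    relabel : ∀ t → y (toℕ t) ≡ select (y 0) (y 3) (aaab t)
    relabel zero                   = refl
    relabel (suc zero)             = sym e₀
    relabel (suc (suc zero))       = sym (trans e₀ e₁)
    relabel (suc (suc (suc zero))) = refl

by-cases : {P : Set ℓ} → (P → ⊥) → (¬ P → ⊥) → ⊥
by-cases yes no = no yes

no-aa-aa : (y : SquareFreeWord A) → let x = letter y in x 0 ≡ x 1 → x 2 ≡ x 3 → ⊥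
no-aa-aa y e₀ e₂ =
  no-square-at-start y (s≤s z≤n) ≤-refl
    (aa-prefix (letter y) e₀) (aa-prefix (letter (suffix 2 y)) e₂)

no-ab-ab : (y : SquareFreeWord A) → let x = letter y in x 0 ≢ x 1 → x 2 ≢ x 3 → ⊥
no-ab-ab y n₀ n₂ =
  no-square-at-start y (s≤s z≤n) ≤-refl
    (ab-prefix (letter y) n₀) (ab-prefix (letter (suffix 2 y)) n₂)

-- No letter occurs three times in a row: x₀x₁x₂ = aaa would force the
-- factor x₀⋯x₇ to be the square aaab·aaab.
no-aaa : (y : SquareFreeWord A) → let x = letter y in x 0 ≡ x 1 → x 1 ≡ x 2 → ⊥
no-aaa y e₀ e₁ =
  no-ab-ab (suffix 2 y) n₂ λ e₄ →
  no-ab-ab (suffix 3 y) n₃ λ e₅ →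
  no-square-at-start y (s≤s z≤n) (m≤m+n 4 4)
    (aaab-prefix (letter y) e₀ e₁ n₂)
    (aaab-prefix (letter (suffix 4 y)) e₄ e₅ (no-aa-aa (suffix 4 y) e₄))
  where
    n₂ : letter y 2 ≢ letter y 3
    n₂ = no-aa-aa y e₀
    n₃ : letter y 3 ≢ letter y 4
    n₃ = no-aa-aa (suffix 1 y) e₁

-- In each case for e₀ = (x₀ ≡ x₁) and e₁ = (x₁ ≡ x₂), the alternation of
-- eᵢ and eᵢ₊₂ yields consecutive eⱼ, eⱼ₊₁ with j ≤ 3, contradicting no-aaa.
theorem33 : ∀ {a : Level} (A : Set a) (w : ℕ → A) → ¬ ParamSquareFree w
theorem33 A w free-w =
  by-cases
    (λ e₀ → by-cases
      (λ e₁ → no-aaa y e₀ e₁)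
      (λ n₁ → no-ab-ab (suffix 1 y) n₁ λ e₃ →
              no-ab-ab (suffix 2 y) (no-aa-aa y e₀) λ e₄ →
              no-aaa (suffix 3 y) e₃ e₄))
    (λ n₀ → by-cases
      (λ e₁ → no-ab-ab y n₀ λ e₂ → no-aaa (suffix 1 y) e₁ e₂)
      (λ n₁ → no-ab-ab y n₀ λ e₂ →
              no-ab-ab (suffix 1 y) n₁ λ e₃ →
              no-aaa (suffix 2 y) e₂ e₃))
  where
    y : SquareFreeWord A
    y = record { letter = w ; free = free-w }
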